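{- Let $H=(V,E,c,\omega)$ be a weighted hypergraph, let $k\ge 1$ be an integer, let $P\subseteq V$, and let $\Pi_P=\{P_1,\ldots,P_k\}$ be a $k$-way prepacking of $P$. Let $O=\langle v_1,\ldots,v_m\rangle$ be the sequence of all vertices of $V\setminus P$ sorted in decreasing order of weight. If the vertices of $O$ are assigned to the blocks of $\Pi_P$ by the LPT algorithm, the resulting $k$-way partition $\Pi=\{V_1,\ldots,V_k\}$ of $V$ (with $P_i\subseteq V_i$ for all $i$) satisfies $$\max_{1\le i\le k} c(V_i)\;\le\;\max\Big\{\tfrac{1}{k}c(P)+h_k(O),\ \max_{1\le i\le k}c(P_i)\Big\},\qquad h_k(O):=\max_{i\in\{1,\ldots,m\}}\Big(c(v_i)+\tfrac{1}{k}\sum_{j=1}^{i-1}c(v_j)\Big).$$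
   Context: A weighted hypergraph $H=(V,E,c,\omega)$ has vertex set $V$, a set $E$ of nets (subsets of $V$), vertex weights $c:V\to\mathbb{R}_{>0}$ and net weights $\omega:E\to\mathbb{R}_{>0}$; for $U\subseteq V$, $c(U):=\sum_{v\in U}c(v)$. A $k$-way partition of a set is a partition into $k$ non-empty pairwise disjoint subsets (blocks); a $k$-way prepacking of $P\subseteq V$ is a $k$-way partition $\{P_1,\ldots,P_k\}$ of $P$. The LPT algorithm applied to the prepacking $\{P_1,\ldots,P_k\}$ and the sequence $O$ processes the vertices of $O$ in the given order and adds each vertex to a block of currently smallest total weight (blocks start as $P_1,\ldots,P_k$).
   Formalization: The vertex weights c and the net weights ω take values in the positive rationals rather than in the positive reals. -}

module Defs where

open import Data.Nat using (ℕ; zero; suc)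
open import Data.Integer using (+_)
open import Data.Fin using (Fin; zero; suc)
open import Data.Fin.Subset using (Subset)
open import Data.List using (List; []; _∷_; map; filter; allFin; foldr)
open import Data.Maybe using (Maybe; just; nothing; is-just)
open import Data.Maybe.Properties using (≡-dec)
open import Data.Fin.Properties using (_≟_)
open import Data.Bool using (T; true; false; if_then_else_)
open import Data.Product using (∃)
open import Relation.Binary.PropositionalEquality using (_≡_)
open import Relation.Nullary.Decidable using (does)
open import Data.Rational using (ℚ; 0ℚ; _<_; _≤_; _+_; _*_; _⊔_; _/_)

record WHypergraph : Set where
  field
    n     : ℕ
    m     : ℕ
    net   : Fin m → Subset n
    c     : Fin n → ℚ
    ω     : Fin m → ℚ
    c-pos : ∀ v → 0ℚ < c v
    ω-pos : ∀ e → 0ℚ < ω e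

sumℚ : List ℚ → ℚ
sumℚ = foldr _+_ 0ℚ

-- A (partial) assignment of vertices to k blocks; nothing = unassigned.
Assign : ℕ → ℕ → Set
Assign n k = Fin n → Maybe (Fin k)

load : ∀ {n k} → (Fin n → ℚ) → Assign n k → Fin k → ℚ
load c f i = sumℚ (map c (filter (λ v → ≡-dec _≟_ (f v) (just i)) (allFin _)))

assignedWeight : ∀ {n k} → (Fin n → ℚ) → Assign n k → ℚ
assignedWeight c f = sumℚ (map c (filter (λ v → Data.Bool.T? (is-just (f v))) (allFin _)))
  where import Data.Bool

-- The prepacking is a k-way partition of P: every block is non-empty
-- (disjointness and covering of P are built into the functional encoding).
IsPrepacking : ∀ {n k} → Assign n k → Set
IsPrepacking {n} {k} p = ∀ (i : Fin k) → ∃ λ (v : Fin n) → p v ≡ just i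

update : ∀ {n k} → Assign n k → Fin n → Fin k → Assign n k
update f v i w = if does (v ≟ w) then just i else f w

-- LPT f O g : some run of the LPT algorithm, started from f, processing O in
-- order, ends in g. Ties between smallest blocks may be broken arbitrarily.
data LPT {n k : ℕ} (c : Fin n → ℚ) : Assign n k → List (Fin n) → Assign n k → Set where
  done : ∀ {f} → LPT c f [] f
  step : ∀ {f v O g} (i : Fin k) →
         (∀ j → load c f i ≤ load c f j) →
         LPT c (update f v i) O g →
         LPT c f (v ∷ O) g

bigmax : ∀ {k} → (Fin (suc k) → ℚ) → ℚ
bigmax {zero}  f = f zero
bigmax {suc k} f = f zero ⊔ bigmax (λ i → f (suc i))

-- hAux k s O = max over positions i of (c(v_i) + (1/k)(s + Σ_{j<i} c(v_j))),
-- with value 0 for the empty sequence.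
hAux : ∀ {n} → (Fin n → ℚ) → (k : ℕ) → ℚ → List (Fin n) → ℚ
hAux c k s [] = 0ℚ
hAux c k s (v ∷ O) = (c v + s * (+ 1 / suc k)) ⊔ hAux c k (s + c v) O

-- h_{k'+1}(O)  (k = suc k')
h : ∀ {n} → (Fin n → ℚ) → (k' : ℕ) → List (Fin n) → ℚ
h c k' O = hAux c k' 0ℚ O

{-# OPTIONS --safe #-}
-- Whenever LPT places a vertex v, the receiving block is a lightest one, so its load is at most
-- the average (1/k)(c(P) + weight placed so far). After receiving v_i it therefore weighs at
-- most c(v_i) + (1/k)(c(P) + Σ_{j<i} c(v_j)) ≤ (1/k)c(P) + h_k(O), while a block that never
-- receives a vertex keeps its prepacked weight.
module Submission where

open import Defs
open import Data.Nat using (ℕ; suc)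
open import Data.Integer using (+_)
open import Data.Fin using (Fin)
open import Data.List using (List)
open import Data.List.Membership.Propositional using (_∈_)
open import Data.List.Relation.Unary.Unique.Propositional using (Unique)
open import Data.List.Relation.Unary.Linked using (Linked)
open import Data.Maybe using (nothing)
open import Relation.Binary.PropositionalEquality using (_≡_)
open import Data.Rational using (_≤_; _+_; _*_; _⊔_; _/_)

import Data.Nat as ℕ
import Data.Integer as ℤ
import Data.Integer.Properties as ℤ
open import Data.Integer.Tactic.RingSolver using (solve-∀)
open import Data.Fin using (zero; suc)
open import Data.Fin.Properties using (_≟_)
open import Data.List using ([]; _∷_; map; filter; tabulate; allFin)
open import Data.List.Relation.Unary.All using (lookup)
open import Data.List.Relation.Unary.AllPairs using (_∷_)
open import Data.List.Relation.Unary.Any using (here; there)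
open import Data.Maybe using (Maybe; just; is-just)
open import Data.Maybe.Properties using (≡-dec)
open import Data.Bool using (Bool; true; false; if_then_else_)
open import Data.Empty using (⊥-elim)
open import Data.Rational using (ℚ; 0ℚ; 1ℚ; toℚᵘ)
import Data.Rational.Properties as ℚ
open import Data.Rational.Solver using (module +-*-Solver)
import Data.Rational.Unnormalised as ℚᵘ
import Data.Rational.Unnormalised.Properties as ℚᵘ
open import Algebra.Bundles using (Ring)
open import Algebra.Properties.CommutativeMonoid.Sum ℚ.+-0-commutativeMonoid
  using (sum; sum-syntax; sum-cong-≗; sum-replicate; sum-replicate-zero; ∑-distrib-+; ∑-comm)
open import Algebra.Properties.Semiring.Mult (Ring.semiring ℚ.+-*-ring)
  using (_×_; ×-assoc-*; ×-comm-*)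
open import Relation.Unary using (Pred; Decidable)
open import Relation.Nullary using (Dec; does; yes; no)
open import Relation.Nullary.Decidable using (T?)
open import Relation.Binary.PropositionalEquality
  using (_≢_; refl; sym; trans; cong; cong₂; module ≡-Reasoning)

select : Bool → ℚ → ℚ
select b x = if b then x else 0ℚ

∑-mono-≤ : ∀ {m} {f g : Fin m → ℚ} → (∀ j → f j ≤ g j) → sum f ≤ sum g
∑-mono-≤ {ℕ.zero} _   = ℚ.≤-refl
∑-mono-≤ {suc m}  f≤g = ℚ.+-mono-≤ (f≤g zero) (∑-mono-≤ (λ j → f≤g (suc j)))

∑-δ : ∀ {m} (i : Fin m) (x : Fin m → ℚ) → ∑[ j < m ] select (does (i ≟ j)) (x j) ≡ x i
∑-δ {suc m} zero    x = trans (cong (_+_ (x zero)) (sum-replicate-zero m)) (ℚ.+-identityʳ (x zero))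
∑-δ {suc m} (suc i) x = trans (ℚ.+-identityˡ _) (∑-δ i (λ j → x (suc j)))

∑-select-≡just : ∀ {k} (x : Maybe (Fin k)) (y : ℚ) →
  ∑[ j < k ] select (does (≡-dec _≟_ x (just j))) y ≡ select (is-just x) y
∑-select-≡just {k} nothing  y = sum-replicate-zero k
∑-select-≡just     (just i) y = ∑-δ i (λ _ → y)

sumℚ-filter : ∀ {a p} {A : Set a} {P : Pred A p} (c : A → ℚ) (P? : Decidable P)
  {m} (x : Fin m → A) →
  sumℚ (map c (filter P? (tabulate x))) ≡ ∑[ v < m ] select (does (P? (x v))) (c (x v))
sumℚ-filter c P? {ℕ.zero} x = refl
sumℚ-filter c P? {suc m}  x with does (P? (x zero))
... | true  = cong (_+_ (c (x zero))) (sumℚ-filter c P? (λ j → x (suc j)))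
... | false = trans (sumℚ-filter c P? (λ j → x (suc j))) (sym (ℚ.+-identityˡ _))

sumℚ-map-nonNeg : ∀ {a} {A : Set a} {c : A → ℚ} → (∀ v → 0ℚ ≤ c v) →
  ∀ xs → 0ℚ ≤ sumℚ (map c xs)
sumℚ-map-nonNeg c≥0 []       = ℚ.≤-refl
sumℚ-map-nonNeg c≥0 (v ∷ xs) = ℚ.+-mono-≤ (c≥0 v) (sumℚ-map-nonNeg c≥0 xs)

-- Normalising ℚ arithmetic does not compute on a variable denominator, so the
-- count is carried out in ℚᵘ.
toℚᵘ-×-1/ : ∀ k' m → toℚᵘ (m × (+ 1 / suc k')) ℚᵘ.≃ ℚᵘ.mkℚᵘ (+ m) k'
toℚᵘ-×-1/ k' ℕ.zero  = ℚᵘ.*≡* refl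
toℚᵘ-×-1/ k' (suc m) =
  ℚᵘ.≃-trans (ℚ.toℚᵘ-homo-+ (+ 1 / K) (m × (+ 1 / K)))
    (ℚᵘ.≃-trans (ℚᵘ.+-cong (ℚ.toℚᵘ-fromℚᵘ (ℚᵘ.mkℚᵘ (+ 1) k')) (toℚᵘ-×-1/ k' m))
      (ℚᵘ.*≡* cross-multiplied))
  where
  K = suc k'
  distrib : ∀ a b → (+ 1 ℤ.* b ℤ.+ a ℤ.* b) ℤ.* b ≡ (+ 1 ℤ.+ a) ℤ.* (b ℤ.* b)
  distrib = solve-∀
  cross-multiplied : (+ 1 ℤ.* + K ℤ.+ + m ℤ.* + K) ℤ.* + K ≡ + suc m ℤ.* + (K ℕ.* K)
  cross-multiplied =
    trans (distrib (+ m) (+ K)) (cong₂ ℤ._*_ (sym (ℤ.pos-+ 1 m)) (sym (ℤ.pos-* K K)))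

n×1/n≡1 : ∀ k' → suc k' × (+ 1 / suc k') ≡ 1ℚ
n×1/n≡1 k' = ℚ.toℚᵘ-injective
  (ℚᵘ.≃-trans (toℚᵘ-×-1/ k' (suc k')) (ℚᵘ.*≡* (ℤ.*-comm (+ suc k') (+ 1))))

≤-mean : ∀ {k'} {a} (F : Fin (suc k') → ℚ) → (∀ j → a ≤ F j) → a ≤ sum F * (+ 1 / suc k')
≤-mean {k'} {a} F a≤F = begin
  a                     ≡⟨ ℚ.*-identityʳ a ⟨
  a * 1ℚ                ≡⟨ cong (a *_) (n×1/n≡1 k') ⟨
  a * (K × q)           ≡⟨ ×-comm-* K a q ⟩
  K × (a * q)           ≡⟨ ×-assoc-* K a q ⟨
  (K × a) * q           ≡⟨ cong (_* q) (sum-replicate K {a}) ⟨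
  (∑[ j < K ] a) * q    ≤⟨ ℚ.*-monoʳ-≤-nonNeg q {{ℚ.normalize-nonNeg 1 K}} (∑-mono-≤ a≤F) ⟩
  sum F * q             ∎
  where
  open ℚ.≤-Reasoning
  K = suc k'
  q = + 1 / K

≤-bigmax : ∀ {k} (f : Fin (suc k) → ℚ) j → f j ≤ bigmax f
≤-bigmax {ℕ.zero} f zero    = ℚ.≤-refl
≤-bigmax {suc k}  f zero    = ℚ.p≤p⊔q _ _
≤-bigmax {suc k}  f (suc j) = ℚ.p≤q⇒p≤r⊔q (f zero) (≤-bigmax (λ i → f (suc i)) j)

bigmax-lub : ∀ {k} (f : Fin (suc k) → ℚ) {x} → (∀ j → f j ≤ x) → bigmax f ≤ x
bigmax-lub {ℕ.zero} f f≤x = f≤x zero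
bigmax-lub {suc k}  f f≤x =
  ℚ.⊔-lub (f≤x zero) (bigmax-lub (λ i → f (suc i)) (λ j → f≤x (suc j)))

update-≢ : ∀ {n k} (f : Assign n k) {v w} (i : Fin k) → v ≢ w → update f v i w ≡ f w
update-≢ f {v} {w} i v≢w with v ≟ w
... | yes v≡w = ⊥-elim (v≢w v≡w)
... | no  _   = refl

module _ {n k : ℕ} (c : Fin n → ℚ) where

  inBlock : Assign n k → Fin k → Fin n → ℚ
  inBlock f j v = select (does (≡-dec _≟_ (f v) (just j))) (c v)

  load≡∑ : ∀ (f : Assign n k) j → load c f j ≡ ∑[ v < n ] inBlock f j v
  load≡∑ f j = sumℚ-filter c (λ v → ≡-dec _≟_ (f v) (just j)) (λ v → v)

  ∑-load≡assignedWeight : ∀ (f : Assign n k) → ∑[ j < k ] load c f j ≡ assignedWeight c f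
  ∑-load≡assignedWeight f = begin
    ∑[ j < k ] load c f j                    ≡⟨ sum-cong-≗ (load≡∑ f) ⟩
    ∑[ j < k ] ∑[ v < n ] inBlock f j v      ≡⟨ ∑-comm (inBlock f) ⟩
    ∑[ v < n ] ∑[ j < k ] inBlock f j v      ≡⟨ sum-cong-≗ {n} (λ v → ∑-select-≡just (f v) (c v)) ⟩
    ∑[ v < n ] select (is-just (f v)) (c v)
      ≡⟨ sumℚ-filter c (λ v → T? (is-just (f v))) (λ v → v) ⟨
    assignedWeight c f                       ∎
    where open ≡-Reasoning

  assignedWeight-nonNeg : (∀ v → 0ℚ ≤ c v) → (f : Assign n k) → 0ℚ ≤ assignedWeight c f
  assignedWeight-nonNeg c≥0 f =
    sumℚ-map-nonNeg c≥0 (filter (λ v → T? (is-just (f v))) (allFin n))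

  inBlock-update : ∀ (f : Assign n k) {v} i j → f v ≡ nothing → ∀ w →
    inBlock (update f v i) j w
      ≡ inBlock f j w + select (does (v ≟ w)) (select (does (i ≟ j)) (c w))
  inBlock-update f {v} i j fv≡nothing w with v ≟ w
  ... | no _ = sym (ℚ.+-identityʳ _)
  ... | yes refl rewrite fv≡nothing with i ≟ j
  ...   | yes _ = sym (ℚ.+-identityˡ _)
  ...   | no _  = sym (ℚ.+-identityˡ _)

  load-update : ∀ (f : Assign n k) {v} i j → f v ≡ nothing →
    load c (update f v i) j ≡ load c f j + select (does (i ≟ j)) (c v)
  load-update f {v} i j fv≡nothing = begin
    load c (update f v i) j                      ≡⟨ load≡∑ (update f v i) j ⟩
    ∑[ w < n ] inBlock (update f v i) j w        ≡⟨ sum-cong-≗ (inBlock-update f i j fv≡nothing) ⟩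
    ∑[ w < n ] (inBlock f j w + δ w)             ≡⟨ ∑-distrib-+ (inBlock f j) δ ⟩
    ∑[ w < n ] inBlock f j w + ∑[ w < n ] δ w
      ≡⟨ cong₂ _+_ (sym (load≡∑ f j)) (∑-δ v (λ w → select (does (i ≟ j)) (c w))) ⟩
    load c f j + select (does (i ≟ j)) (c v)     ∎
    where
    open ≡-Reasoning
    δ : Fin n → ℚ
    δ w = select (does (v ≟ w)) (select (does (i ≟ j)) (c w))

  assignedWeight-update : ∀ (f : Assign n k) {v} i → f v ≡ nothing →
    assignedWeight c (update f v i) ≡ assignedWeight c f + c v
  assignedWeight-update f {v} i fv≡nothing = begin
    assignedWeight c (update f v i)          ≡⟨ ∑-load≡assignedWeight (update f v i) ⟨
    ∑[ j < k ] load c (update f v i) j       ≡⟨ sum-cong-≗ (λ j → load-update f i j fv≡nothing) ⟩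
    ∑[ j < k ] (load c f j + select (does (i ≟ j)) (c v))
      ≡⟨ ∑-distrib-+ (load c f) _ ⟩
    ∑[ j < k ] load c f j + ∑[ j < k ] select (does (i ≟ j)) (c v)
      ≡⟨ cong₂ _+_ (∑-load≡assignedWeight f) (∑-δ i (λ _ → c v)) ⟩
    assignedWeight c f + c v                 ∎
    where open ≡-Reasoning

  load-update-≤ : ∀ (f : Assign n k) {v} i j → f v ≡ nothing →
    load c (update f v i) j ≤ load c f j ⊔ (c v + load c f i)
  load-update-≤ f {v} i j fv≡nothing =
    ℚ.≤-trans (ℚ.≤-reflexive (load-update f i j fv≡nothing)) (by-cases (i ≟ j))
    where
    by-cases : (i≟j : Dec (i ≡ j)) →
      load c f j + select (does i≟j) (c v) ≤ load c f j ⊔ (c v + load c f i)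
    by-cases (yes refl) = ℚ.p≤q⇒p≤r⊔q (load c f i) (ℚ.≤-reflexive (ℚ.+-comm (load c f i) (c v)))
    by-cases (no _)     = ℚ.p≤q⇒p≤q⊔r _ (ℚ.≤-reflexive (ℚ.+-identityʳ (load c f j)))

module _ {n k' : ℕ} (c : Fin n → ℚ) where

  private
    q : ℚ
    q = + 1 / suc k'

  lightest≤mean : ∀ (f : Assign n (suc k')) i → (∀ j → load c f i ≤ load c f j) →
    load c f i ≤ assignedWeight c f * q
  lightest≤mean f i lightest = ℚ.≤-trans (≤-mean (load c f) lightest)
    (ℚ.≤-reflexive (cong (_* q) (∑-load≡assignedWeight c f)))

  LPT-load-≤ : ∀ {f O g} → LPT c f O g → Unique O → (∀ w → w ∈ O → f w ≡ nothing) →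
    ∀ j → load c g j ≤ load c f j ⊔ hAux c k' (assignedWeight c f) O
  LPT-load-≤ done _ _ j = ℚ.p≤p⊔q _ _
  LPT-load-≤ {f} {g = g} (step {v = v} {O = O} i lightest run) (v∉O ∷ unique) fresh j = begin
    load c g j                                             ≤⟨ LPT-load-≤ run unique fresh′ j ⟩
    load c f′ j ⊔ hAux c k' (assignedWeight c f′) O
      ≡⟨ cong (λ s → load c f′ j ⊔ hAux c k' s O) (assignedWeight-update c f i fv≡nothing) ⟩
    load c f′ j ⊔ hAux c k' (W + c v) O                    ≤⟨ ℚ.⊔-monoˡ-≤ _ load-f′ ⟩
    (load c f j ⊔ (c v + W * q)) ⊔ hAux c k' (W + c v) O
      ≡⟨ ℚ.⊔-assoc (load c f j) (c v + W * q) (hAux c k' (W + c v) O) ⟩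
    load c f j ⊔ hAux c k' W (v ∷ O)                       ∎
    where
    open ℚ.≤-Reasoning
    f′ = update f v i
    W = assignedWeight c f
    fv≡nothing : f v ≡ nothing
    fv≡nothing = fresh v (here refl)
    fresh′ : ∀ w → w ∈ O → f′ w ≡ nothing
    fresh′ w w∈O = trans (update-≢ f i (lookup v∉O w∈O)) (fresh w (there w∈O))
    load-f′ : load c f′ j ≤ load c f j ⊔ (c v + W * q)
    load-f′ = ℚ.≤-trans (load-update-≤ c f i j fv≡nothing)
      (ℚ.⊔-monoʳ-≤ (load c f j) (ℚ.+-monoʳ-≤ (c v) (lightest≤mean f i lightest)))

  hAux-+-≤ : ∀ s {t} O → 0ℚ ≤ t → hAux c k' (s + t) O ≤ t * q + hAux c k' s O
  hAux-+-≤ s {t} [] 0≤t = begin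
    0ℚ           ≡⟨ ℚ.*-zeroˡ q ⟨
    0ℚ * q       ≤⟨ ℚ.*-monoʳ-≤-nonNeg q {{ℚ.normalize-nonNeg 1 (suc k')}} 0≤t ⟩
    t * q        ≡⟨ ℚ.+-identityʳ (t * q) ⟨
    t * q + 0ℚ   ∎
    where open ℚ.≤-Reasoning
  hAux-+-≤ s {t} (v ∷ O) 0≤t = ℚ.⊔-lub first rest
    where
    open ℚ.≤-Reasoning
    open +-*-Solver
    first : c v + (s + t) * q ≤ t * q + hAux c k' s (v ∷ O)
    first = begin
      c v + (s + t) * q
        ≡⟨ solve 4 (λ x s t q → x :+ (s :+ t) :* q := t :* q :+ (x :+ s :* q)) refl (c v) s t q ⟩
      t * q + (c v + s * q)          ≤⟨ ℚ.+-monoʳ-≤ (t * q) (ℚ.p≤p⊔q _ _) ⟩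
      t * q + hAux c k' s (v ∷ O)    ∎
    rest : hAux c k' (s + t + c v) O ≤ t * q + hAux c k' s (v ∷ O)
    rest = begin
      hAux c k' (s + t + c v) O
        ≡⟨ cong (λ s′ → hAux c k' s′ O) (solve 3 (λ s t x → s :+ t :+ x := s :+ x :+ t) refl s t (c v)) ⟩
      hAux c k' (s + c v + t) O      ≤⟨ hAux-+-≤ (s + c v) O 0≤t ⟩
      t * q + hAux c k' (s + c v) O  ≤⟨ ℚ.+-monoʳ-≤ (t * q) (ℚ.p≤q⊔p (c v + s * q) _) ⟩
      t * q + hAux c k' s (v ∷ O)    ∎

  hAux≤h : ∀ {t} O → 0ℚ ≤ t → hAux c k' t O ≤ t * q + h c k' O
  hAux≤h {t} O 0≤t = ℚ.≤-trans
    (ℚ.≤-reflexive (cong (λ s → hAux c k' s O) (sym (ℚ.+-identityˡ t))))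
    (hAux-+-≤ 0ℚ O 0≤t)

lemma3 : (H : WHypergraph) → let open WHypergraph H in
    (k' : ℕ) (p : Assign n (suc k')) → IsPrepacking p →
    (O : List (Fin n)) → Unique O →
    (∀ v → v ∈ O → p v ≡ nothing) → (∀ v → p v ≡ nothing → v ∈ O) →
    Linked (λ u w → c w ≤ c u) O →
    (g : Assign n (suc k')) → LPT c p O g →
    bigmax (load c g)
      ≤ (assignedWeight c p * (+ 1 / suc k') + h c k' O) ⊔ bigmax (load c p)
lemma3 H k' p _ O unique fresh _ _ g run = bigmax-lub (load c g) λ j → begin
  load c g j                                  ≤⟨ LPT-load-≤ c run unique fresh j ⟩
  load c p j ⊔ hAux c k' W O                  ≤⟨ ℚ.⊔-mono-≤ (≤-bigmax (load c p) j) (hAux≤h c O 0≤W) ⟩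
  bigmax (load c p) ⊔ (W * q + h c k' O)      ≡⟨ ℚ.⊔-comm (bigmax (load c p)) _ ⟩
  (W * q + h c k' O) ⊔ bigmax (load c p)      ∎
  where
  open WHypergraph H
  open ℚ.≤-Reasoning
  q = + 1 / suc k'
  W = assignedWeight c p
  0≤W : 0ℚ ≤ W
  0≤W = assignedWeight-nonNeg c (λ v → ℚ.<⇒≤ (c-pos v)) p
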